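{- Let $v \equiv 0 \pmod 4$ and let $H=[h_{ij}]_{i,j=0}^{v-1}$ be a Hadamard matrix of order $v$ (entries in $\{+1,-1\}$, $HH^T=vI$) which is a Toeplitz matrix, i.e. $h_{i,j}=h_{i-1,j-1}$ for all $i,j>0$. Then $H$ is cyclic or negacyclic.
   Context: Let $P$ be the $v\times v$ cyclic shift matrix (entries $P_{i,i+1}=1$ for $0\le i\le v-2$, $P_{v-1,0}=1$, all other entries $0$) and $N$ the $v\times v$ negacyclic shift matrix (same as $P$ except $N_{v-1,0}=-1$). A matrix of order $v$ is called cyclic (circulant) if it is a polynomial in $P$, and negacyclic if it is a polynomial in $N$. -}

module Defs where

open import Data.Nat as ℕ using (ℕ; zero; suc; _∸_)
open import Data.Integer using (ℤ; +_; -_; _+_; _*_; 0ℤ; 1ℤ)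
import Data.Fin as Fin
open import Data.Fin using (Fin; toℕ)
open import Data.List using (List; []; _∷_)
open import Data.Bool using (if_then_else_)
open import Data.Sum using (_⊎_)
open import Data.Product using (∃; _×_)
open import Relation.Binary.PropositionalEquality using (_≡_)
open import Relation.Nullary.Decidable using (⌊_⌋)

Mat : ℕ → Set
Mat v = Fin v → Fin v → ℤ

∑ : {n : ℕ} → (Fin n → ℤ) → ℤ
∑ {zero}  f = 0ℤ
∑ {suc n} f = f Fin.zero + ∑ (λ i → f (Fin.suc i))

_·_ : {v : ℕ} → Mat v → Mat v → Mat v
(A · B) i k = ∑ (λ j → A i j * B j k)

transpose : {v : ℕ} → Mat v → Mat v
transpose A i j = A j i

identity : {v : ℕ} → Mat v
identity i j = if ⌊ toℕ i ℕ.≟ toℕ j ⌋ then 1ℤ else 0ℤ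

scale : {v : ℕ} → ℤ → Mat v → Mat v
scale c A i j = c * A i j

madd : {v : ℕ} → Mat v → Mat v → Mat v
madd A B i j = A i j + B i j

zeroM : {v : ℕ} → Mat v
zeroM i j = 0ℤ

cyclicShift : (v : ℕ) → Mat v
cyclicShift v i j =
  if ⌊ toℕ j ℕ.≟ suc (toℕ i) ⌋ then 1ℤ
  else if ⌊ toℕ i ℕ.≟ v ∸ 1 ⌋ then (if ⌊ toℕ j ℕ.≟ 0 ⌋ then 1ℤ else 0ℤ)
  else 0ℤ

negacyclicShift : (v : ℕ) → Mat v
negacyclicShift v i j =
  if ⌊ toℕ j ℕ.≟ suc (toℕ i) ⌋ then 1ℤ
  else if ⌊ toℕ i ℕ.≟ v ∸ 1 ⌋ then (if ⌊ toℕ j ℕ.≟ 0 ⌋ then - 1ℤ else 0ℤ)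
  else 0ℤ

polyEval : {v : ℕ} → List ℤ → Mat v → Mat v
polyEval []       M = zeroM
polyEval (c ∷ cs) M = madd (scale c identity) (M · polyEval cs M)

_≋_ : {v : ℕ} → Mat v → Mat v → Set
A ≋ B = ∀ i j → A i j ≡ B i j

IsPolyIn : {v : ℕ} → Mat v → Mat v → Set
IsPolyIn {v} A M = ∃ λ (cs : List ℤ) → A ≋ polyEval cs M

IsCyclic : (v : ℕ) → Mat v → Set
IsCyclic v A = IsPolyIn A (cyclicShift v)

IsNegacyclic : (v : ℕ) → Mat v → Set
IsNegacyclic v A = IsPolyIn A (negacyclicShift v)

IsHadamard : (v : ℕ) → Mat v → Set
IsHadamard v H =
  (∀ i j → (H i j ≡ 1ℤ) ⊎ (H i j ≡ - 1ℤ)) × (H · transpose H) ≋ scale (+ v) identity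

IsToeplitz : (v : ℕ) → Mat v → Set
IsToeplitz v H = ∀ (i j i' j' : Fin v) → toℕ i ≡ suc (toℕ i') → toℕ j ≡ suc (toℕ j') →
  H i j ≡ H i' j'

module Submission where

-- Write S_ε for the shift matrix with ones on the superdiagonal and ε in the
-- bottom-left corner (S_1 = P, S_-1 = N).  The proof has three parts.
--
-- The ε-circulant generated by a : ℕ → ℤ has entry
--    a(j-i) on and above the diagonal and ε·a(v+j-i) below it.  Left
--    multiplication by S_ε and adding c·I keep this shape (with a rotated,
--    resp. its head bumped by c), so by Horner's scheme every polynomial in S_ε
--    is an ε-circulant whose generator is computed from the coefficients.  For
--    the coefficient list "first row of H" that generator is the first row.
-- 2. Rigidity.  A matrix constant along diagonals that satisfies the wrap rule
--    Q(i+1,0) = ε·Q(i,n) is determined by its first row (induction on rows).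
-- 3. Orthogonality.  Rows i+1, k+1 and rows i, k of a Toeplitz matrix have the
--    same inner product apart from one term each, so for i ≠ k Hadamard gives
--    H(i+1,0)H(k+1,0) = H(i,n)H(k,n); taking k = 0 yields the wrap rule with
--    ε = H(1,0)·H(0,n).
--
-- Hence H and the polynomial in S_ε with coefficients its first row agree.

open import Defs
open import Data.Nat as ℕ using (ℕ; zero; suc; _∸_; _≤_; _<_; z≤n; s≤s; _%_)
import Data.Nat.Properties as ℕₚ
open import Data.Integer using (ℤ; -_; _+_; _*_; 0ℤ; 1ℤ)
import Data.Integer as ℤ
import Data.Integer.Properties as ℤₚ
open import Algebra.Properties.AbelianGroup ℤₚ.+-0-abelianGroup
  using (inverseˡ-unique; inverseʳ-unique)
open import Data.Fin using (Fin; zero; suc; toℕ; fromℕ; fromℕ<; inject₁)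
import Data.Fin.Properties as Finₚ
open import Data.Fin.Induction using (<-weakInduction)
open import Data.List using (List; []; _∷_; tabulate)
open import Data.Bool using (if_then_else_)
open import Data.Sum using (_⊎_; inj₁; inj₂)
open import Data.Product using (∃; _×_; _,_)
open import Data.Empty using (⊥-elim)
open import Function using (_∘_)
open import Relation.Nullary using (yes; no)
open import Relation.Nullary.Decidable using (⌊_⌋)
open import Relation.Binary.Definitions using (tri<; tri≈; tri>)
open import Relation.Binary.PropositionalEquality
open ≡-Reasoning

∑-cong : ∀ {n} {f g : Fin n → ℤ} → (∀ j → f j ≡ g j) → ∑ f ≡ ∑ g
∑-cong {zero}  eq = refl
∑-cong {suc n} eq = cong₂ _+_ (eq zero) (∑-cong (eq ∘ suc))

∑-zero : ∀ {n} (f : Fin n → ℤ) → (∀ j → f j ≡ 0ℤ) → ∑ f ≡ 0ℤ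
∑-zero {zero}  f vanish = refl
∑-zero {suc n} f vanish = cong₂ _+_ (vanish zero) (∑-zero (f ∘ suc) (vanish ∘ suc))

-- A sum with a single possibly nonzero term equals that term; this is how a
-- product with a row of the shift matrix selects one entry.
∑-single : ∀ {n} (f : Fin n → ℤ) (k : Fin n) → (∀ j → j ≢ k → f j ≡ 0ℤ) → ∑ f ≡ f k
∑-single f zero others =
  trans (cong (f zero +_) (∑-zero (f ∘ suc) (λ j → others (suc j) λ ())))
        (ℤₚ.+-identityʳ (f zero))
∑-single f (suc k) others =
  trans (cong (_+ ∑ (f ∘ suc)) (others zero λ ()))
        (trans (ℤₚ.+-identityˡ _)
               (∑-single (f ∘ suc) k λ j j≢k → others (suc j) (j≢k ∘ Finₚ.suc-injective)))

∑-last : ∀ {n} (f : Fin (suc n) → ℤ) → ∑ f ≡ ∑ (f ∘ inject₁) + f (fromℕ n)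
∑-last {zero}  f = trans (ℤₚ.+-identityʳ (f zero)) (sym (ℤₚ.+-identityˡ (f zero)))
∑-last {suc n} f = trans (cong (f zero +_) (∑-last (f ∘ suc)))
                         (sym (ℤₚ.+-assoc (f zero) _ (f (suc (fromℕ n)))))

identity-diagonal : ∀ {v} (i j : Fin v) → toℕ i ≡ toℕ j → identity i j ≡ 1ℤ
identity-diagonal i j i≡j with toℕ i ℕ.≟ toℕ j
... | yes _   = refl
... | no  i≢j = ⊥-elim (i≢j i≡j)

identity-offDiagonal : ∀ {v} (i j : Fin v) → toℕ i ≢ toℕ j → identity i j ≡ 0ℤ
identity-offDiagonal i j i≢j with toℕ i ℕ.≟ toℕ j
... | yes i≡j = ⊥-elim (i≢j i≡j)
... | no  _   = refl

-- The ε-twisted shift S_ε: shift v 1ℤ is cyclicShift v and shift v (- 1ℤ)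
-- is negacyclicShift v, definitionally.
shift : (v : ℕ) → ℤ → Mat v
shift v ε i j =
  if ⌊ toℕ j ℕ.≟ suc (toℕ i) ⌋ then 1ℤ
  else if ⌊ toℕ i ℕ.≟ v ∸ 1 ⌋ then (if ⌊ toℕ j ℕ.≟ 0 ⌋ then ε else 0ℤ)
  else 0ℤ

module _ {v : ℕ} (ε : ℤ) where

  shift-superdiagonal : (i k : Fin v) → toℕ k ≡ suc (toℕ i) → shift v ε i k ≡ 1ℤ
  shift-superdiagonal i k k≡1+i with toℕ k ℕ.≟ suc (toℕ i)
  ... | yes _     = refl
  ... | no  k≢1+i = ⊥-elim (k≢1+i k≡1+i)

  shift-innerRow : (i k : Fin v) → toℕ k ≢ suc (toℕ i) → toℕ i ≢ v ∸ 1 →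
                   shift v ε i k ≡ 0ℤ
  shift-innerRow i k k≢1+i notLast with toℕ k ℕ.≟ suc (toℕ i)
  ... | yes k≡1+i = ⊥-elim (k≢1+i k≡1+i)
  ... | no _ with toℕ i ℕ.≟ v ∸ 1
  ...   | yes last = ⊥-elim (notLast last)
  ...   | no _     = refl

  shift-corner : (i k : Fin v) → toℕ k ≢ suc (toℕ i) → toℕ i ≡ v ∸ 1 → toℕ k ≡ 0 →
                 shift v ε i k ≡ ε
  shift-corner i k k≢1+i last first with toℕ k ℕ.≟ suc (toℕ i)
  ... | yes k≡1+i = ⊥-elim (k≢1+i k≡1+i)
  ... | no _ with toℕ i ℕ.≟ v ∸ 1
  ...   | no notLast = ⊥-elim (notLast last)
  ...   | yes _ with toℕ k ℕ.≟ 0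
  ...     | yes _        = refl
  ...     | no  notFirst = ⊥-elim (notFirst first)

  shift-laterColumn : (i k : Fin v) → toℕ k ≢ suc (toℕ i) → toℕ k ≢ 0 →
                      shift v ε i k ≡ 0ℤ
  shift-laterColumn i k k≢1+i notFirst with toℕ k ℕ.≟ suc (toℕ i)
  ... | yes k≡1+i = ⊥-elim (k≢1+i k≡1+i)
  ... | no _ with toℕ i ℕ.≟ v ∸ 1
  ...   | no _ = refl
  ...   | yes _ with toℕ k ℕ.≟ 0
  ...     | yes first = ⊥-elim (notFirst first)
  ...     | no _      = refl

module _ {n : ℕ} (ε : ℤ) (Q : Mat (suc n)) where

  shift-mul-innerRow : (i j : Fin (suc n)) (p : suc (toℕ i) < suc n) →
                       (shift (suc n) ε · Q) i j ≡ Q (fromℕ< p) j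
  shift-mul-innerRow i j p = begin
    ∑ (λ k → shift (suc n) ε i k * Q k j)
      ≡⟨ ∑-single _ i⁺ others ⟩
    shift (suc n) ε i i⁺ * Q i⁺ j
      ≡⟨ cong (_* Q i⁺ j) (shift-superdiagonal ε i i⁺ (Finₚ.toℕ-fromℕ< p)) ⟩
    1ℤ * Q i⁺ j
      ≡⟨ ℤₚ.*-identityˡ _ ⟩
    Q i⁺ j ∎
    where
    i⁺ = fromℕ< p
    others : ∀ k → k ≢ i⁺ → shift (suc n) ε i k * Q k j ≡ 0ℤ
    others k k≢i⁺ = cong (_* Q k j) (shift-innerRow ε i k
      (λ k≡1+i → k≢i⁺ (Finₚ.toℕ-injective (trans k≡1+i (sym (Finₚ.toℕ-fromℕ< p)))))
      (λ last → ℕₚ.<-irrefl last (ℕₚ.≤-pred p)))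

  shift-mul-lastRow : (i j : Fin (suc n)) → toℕ i ≡ n →
                      (shift (suc n) ε · Q) i j ≡ ε * Q zero j
  shift-mul-lastRow i j last =
    trans (∑-single _ zero others) (cong (_* Q zero j) (shift-corner ε i zero (λ ()) last refl))
    where
    others : ∀ k → k ≢ zero → shift (suc n) ε i k * Q k j ≡ 0ℤ
    others k k≢0 = cong (_* Q k j) (shift-laterColumn ε i k
      (λ k≡1+i → ℕₚ.<-irrefl (trans k≡1+i (cong suc last)) (Finₚ.toℕ<n k))
      (k≢0 ∘ Finₚ.toℕ-injective))

-- The entry formula is
-- stated for arbitrary row and column numbers r, c; its row r = v is ε times
-- row 0, which lets the last row of S_ε · C be read off uniformly.
circulantEntry : ℕ → ℤ → (ℕ → ℤ) → ℕ → ℕ → ℤ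
circulantEntry v ε a r c with r ℕ.≤? c
... | yes _ = a (c ∸ r)
... | no  _ = ε * a (v ℕ.+ c ∸ r)

circulant : (v : ℕ) → ℤ → (ℕ → ℤ) → Mat v
circulant v ε a i j = circulantEntry v ε a (toℕ i) (toℕ j)

module _ {v : ℕ} {ε : ℤ} where

  entry-above : ∀ a {r c} → r ≤ c → circulantEntry v ε a r c ≡ a (c ∸ r)
  entry-above a {r} {c} r≤c with r ℕ.≤? c
  ... | yes _   = refl
  ... | no  r≰c = ⊥-elim (r≰c r≤c)

  entry-below : ∀ a {r c} → c < r → circulantEntry v ε a r c ≡ ε * a (v ℕ.+ c ∸ r)
  entry-below a {r} {c} c<r with r ℕ.≤? c
  ... | yes r≤c = ⊥-elim (ℕₚ.<-irrefl refl (ℕₚ.<-≤-trans c<r r≤c))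
  ... | no  _   = refl

  entry-alongDiagonal : ∀ a r c →
                        circulantEntry v ε a (suc r) (suc c) ≡ circulantEntry v ε a r c
  entry-alongDiagonal a r c with ℕₚ.≤-<-connex r c
  ... | inj₁ r≤c = trans (entry-above a (s≤s r≤c)) (sym (entry-above a r≤c))
  ... | inj₂ c<r = begin
    circulantEntry v ε a (suc r) (suc c) ≡⟨ entry-below a (s≤s c<r) ⟩
    ε * a (v ℕ.+ suc c ∸ suc r)
      ≡⟨ cong (λ m → ε * a (m ∸ suc r)) (ℕₚ.+-suc v c) ⟩
    ε * a (v ℕ.+ c ∸ r)                  ≡⟨ sym (entry-below a c<r) ⟩
    circulantEntry v ε a r c             ∎

  circulant-zero : ∀ r c → circulantEntry v ε (λ _ → 0ℤ) r c ≡ 0ℤ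
  circulant-zero r c with ℕₚ.≤-<-connex r c
  ... | inj₁ r≤c = entry-above (λ _ → 0ℤ) r≤c
  ... | inj₂ c<r = trans (entry-below (λ _ → 0ℤ) c<r) (ℤₚ.*-zeroʳ ε)

rotate : ℕ → ℤ → (ℕ → ℤ) → ℕ → ℤ
rotate n ε a zero    = ε * a n
rotate n ε a (suc k) = a k

bumpHead : ℤ → (ℕ → ℤ) → ℕ → ℤ
bumpHead c a zero    = c + a zero
bumpHead c a (suc k) = a (suc k)

bumpHead-tail : ∀ c a k → k ≢ 0 → bumpHead c a k ≡ a k
bumpHead-tail c a zero    k≢0 = ⊥-elim (k≢0 refl)
bumpHead-tail c a (suc k) _   = refl

module _ {n : ℕ} {ε : ℤ} where

  entry-pastLastRow : ∀ a {c} → c ≤ n → circulantEntry (suc n) ε a (suc n) c ≡ ε * a c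
  entry-pastLastRow a {c} c≤n =
    trans (entry-below a (s≤s c≤n)) (cong (λ m → ε * a m) (ℕₚ.m+n∸m≡n n c))

  entry-rotate : ∀ a {r} c → r ≤ n →
                 circulantEntry (suc n) ε a (suc r) c ≡ circulantEntry (suc n) ε (rotate n ε a) r c
  entry-rotate a {r} c r≤n with ℕₚ.<-cmp r c
  ... | tri< r<c _ _ = begin
    circulantEntry (suc n) ε a (suc r) c ≡⟨ entry-above a r<c ⟩
    a (c ∸ suc r)                        ≡⟨ cong (rotate n ε a) (sym (ℕₚ.+-∸-assoc 1 r<c)) ⟩
    rotate n ε a (c ∸ r)                 ≡⟨ sym (entry-above (rotate n ε a) (ℕₚ.<⇒≤ r<c)) ⟩
    circulantEntry (suc n) ε (rotate n ε a) r c ∎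
  ... | tri≈ _ refl _ = begin
    circulantEntry (suc n) ε a (suc r) r ≡⟨ entry-below a (ℕₚ.n<1+n r) ⟩
    ε * a (n ℕ.+ r ∸ r)                  ≡⟨ cong (λ m → ε * a m) (ℕₚ.m+n∸n≡m n r) ⟩
    rotate n ε a 0                       ≡⟨ cong (rotate n ε a) (sym (ℕₚ.n∸n≡0 r)) ⟩
    rotate n ε a (r ∸ r)
      ≡⟨ sym (entry-above {suc n} {ε} (rotate n ε a) {r} ℕₚ.≤-refl) ⟩
    circulantEntry (suc n) ε (rotate n ε a) r r ∎
  ... | tri> _ _ c<r = begin
    circulantEntry (suc n) ε a (suc r) c ≡⟨ entry-below a (ℕₚ.m<n⇒m<1+n c<r) ⟩
    ε * a (n ℕ.+ c ∸ r)
      ≡⟨ cong (ε *_) (cong (rotate n ε a) (sym (ℕₚ.+-∸-assoc 1 r≤n+c))) ⟩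
    ε * rotate n ε a (suc n ℕ.+ c ∸ r)   ≡⟨ sym (entry-below (rotate n ε a) c<r) ⟩
    circulantEntry (suc n) ε (rotate n ε a) r c ∎
    where r≤n+c = ℕₚ.≤-trans r≤n (ℕₚ.m≤m+n n c)

  circulant-addDiagonal : ∀ c a (i j : Fin (suc n)) →
    c * identity i j + circulant (suc n) ε a i j ≡ circulant (suc n) ε (bumpHead c a) i j
  circulant-addDiagonal c a i j with ℕₚ.<-cmp (toℕ i) (toℕ j)
  ... | tri< i<j _ _ = begin
    c * identity i j + circulant (suc n) ε a i j
      ≡⟨ cong₂ _+_ offDiagonal (entry-above a (ℕₚ.<⇒≤ i<j)) ⟩
    0ℤ + a (toℕ j ∸ toℕ i)       ≡⟨ ℤₚ.+-identityˡ _ ⟩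
    a (toℕ j ∸ toℕ i)            ≡⟨ sym (bumpHead-tail c a _ (ℕₚ.m>n⇒m∸n≢0 i<j)) ⟩
    bumpHead c a (toℕ j ∸ toℕ i) ≡⟨ sym (entry-above (bumpHead c a) (ℕₚ.<⇒≤ i<j)) ⟩
    circulant (suc n) ε (bumpHead c a) i j ∎
    where
    offDiagonal = trans (cong (c *_) (identity-offDiagonal i j (ℕₚ.<⇒≢ i<j))) (ℤₚ.*-zeroʳ c)
  ... | tri≈ _ i≡j _ = begin
    c * identity i j + circulant (suc n) ε a i j
      ≡⟨ cong₂ _+_ diagonal (entry-above a (ℕₚ.≤-reflexive i≡j)) ⟩
    c + a (toℕ j ∸ toℕ i)        ≡⟨ cong (λ m → c + a m) j∸i≡0 ⟩
    bumpHead c a 0               ≡⟨ cong (bumpHead c a) (sym j∸i≡0) ⟩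
    bumpHead c a (toℕ j ∸ toℕ i) ≡⟨ sym (entry-above (bumpHead c a) (ℕₚ.≤-reflexive i≡j)) ⟩
    circulant (suc n) ε (bumpHead c a) i j ∎
    where
    diagonal = trans (cong (c *_) (identity-diagonal i j i≡j)) (ℤₚ.*-identityʳ c)
    j∸i≡0 = trans (cong (toℕ j ∸_) i≡j) (ℕₚ.n∸n≡0 (toℕ j))
  ... | tri> _ _ j<i = begin
    c * identity i j + circulant (suc n) ε a i j
      ≡⟨ cong₂ _+_ offDiagonal (entry-below a j<i) ⟩
    0ℤ + ε * a m       ≡⟨ ℤₚ.+-identityˡ _ ⟩
    ε * a m            ≡⟨ cong (ε *_) (sym (bumpHead-tail c a m (ℕₚ.m>n⇒m∸n≢0 i<v+j))) ⟩
    ε * bumpHead c a m ≡⟨ sym (entry-below (bumpHead c a) j<i) ⟩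
    circulant (suc n) ε (bumpHead c a) i j ∎
    where
    m = suc n ℕ.+ toℕ j ∸ toℕ i
    offDiagonal = trans (cong (c *_) (identity-offDiagonal i j (ℕₚ.>⇒≢ j<i))) (ℤₚ.*-zeroʳ c)
    i<v+j = ℕₚ.<-≤-trans (Finₚ.toℕ<n i) (ℕₚ.m≤m+n (suc n) (toℕ j))

  shift-mul-circulant : ∀ {a} (Q : Mat (suc n)) → Q ≋ circulant (suc n) ε a → (i j : Fin (suc n)) →
    (shift (suc n) ε · Q) i j ≡ circulantEntry (suc n) ε a (suc (toℕ i)) (toℕ j)
  shift-mul-circulant {a} Q Q≋C i j with ℕₚ.m≤n⇒m<n∨m≡n (ℕₚ.≤-pred (Finₚ.toℕ<n i))
  ... | inj₁ i<n = begin
    (shift (suc n) ε · Q) i j                   ≡⟨ shift-mul-innerRow ε Q i j (s≤s i<n) ⟩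
    Q i⁺ j                                      ≡⟨ Q≋C i⁺ j ⟩
    circulantEntry (suc n) ε a (toℕ i⁺) (toℕ j)
      ≡⟨ cong (λ r → circulantEntry (suc n) ε a r (toℕ j)) (Finₚ.toℕ-fromℕ< (s≤s i<n)) ⟩
    circulantEntry (suc n) ε a (suc (toℕ i)) (toℕ j) ∎
    where i⁺ = fromℕ< (s≤s i<n)
  ... | inj₂ i≡n = begin
    (shift (suc n) ε · Q) i j                  ≡⟨ shift-mul-lastRow ε Q i j i≡n ⟩
    ε * Q zero j
      ≡⟨ cong (ε *_) (trans (Q≋C zero j) (entry-above {suc n} {ε} a z≤n)) ⟩
    ε * a (toℕ j)                              ≡⟨ sym (entry-pastLastRow a (ℕₚ.≤-pred (Finₚ.toℕ<n j))) ⟩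
    circulantEntry (suc n) ε a (suc n) (toℕ j)
      ≡⟨ cong (λ r → circulantEntry (suc n) ε a (suc r) (toℕ j)) (sym i≡n) ⟩
    circulantEntry (suc n) ε a (suc (toℕ i)) (toℕ j) ∎

generator : ℕ → ℤ → List ℤ → ℕ → ℤ
generator n ε []       = λ _ → 0ℤ
generator n ε (c ∷ cs) = bumpHead c (rotate n ε (generator n ε cs))

module _ {n : ℕ} {ε : ℤ} where

  polynomial-circulant : ∀ cs →
                         polyEval cs (shift (suc n) ε) ≋ circulant (suc n) ε (generator n ε cs)
  polynomial-circulant []       i j = sym (circulant-zero (toℕ i) (toℕ j))
  polynomial-circulant (c ∷ cs) i j = begin
    c * identity i j + (shift (suc n) ε · polyEval cs (shift (suc n) ε)) i j
      ≡⟨ cong (c * identity i j +_) (shift-mul-circulant _ (polynomial-circulant cs) i j) ⟩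
    c * identity i j + circulantEntry (suc n) ε a (suc (toℕ i)) (toℕ j)
      ≡⟨ cong (c * identity i j +_) (entry-rotate a (toℕ j) (ℕₚ.≤-pred (Finₚ.toℕ<n i))) ⟩
    c * identity i j + circulant (suc n) ε (rotate n ε a) i j
      ≡⟨ circulant-addDiagonal c (rotate n ε a) i j ⟩
    circulant (suc n) ε (generator n ε (c ∷ cs)) i j ∎
    where a = generator n ε cs

  generator-beyond : ∀ {m} (f : Fin m → ℤ) k → m ≤ k → generator n ε (tabulate f) k ≡ 0ℤ
  generator-beyond {zero}  f k       _         = refl
  generator-beyond {suc m} f (suc k) (s≤s m≤k) = generator-beyond (f ∘ suc) k m≤k

  generator-tabulate : ∀ {m} → m ≤ suc n → (f : Fin m → ℤ) (k : Fin m) →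
                       generator n ε (tabulate f) (toℕ k) ≡ f k
  generator-tabulate (s≤s m≤n) f zero = begin
    f zero + ε * generator n ε (tabulate (f ∘ suc)) n
      ≡⟨ cong (λ x → f zero + ε * x) (generator-beyond (f ∘ suc) n m≤n) ⟩
    f zero + ε * 0ℤ ≡⟨ cong (f zero +_) (ℤₚ.*-zeroʳ ε) ⟩
    f zero + 0ℤ     ≡⟨ ℤₚ.+-identityʳ (f zero) ⟩
    f zero          ∎
  generator-tabulate (s≤s m≤n) f (suc k) =
    generator-tabulate (ℕₚ.m≤n⇒m≤1+n m≤n) (f ∘ suc) k

DiagonalConstant : ∀ {n} → Mat (suc n) → Set
DiagonalConstant {n} Q = ∀ (i j : Fin n) → Q (suc i) (suc j) ≡ Q (inject₁ i) (inject₁ j)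

Wraps : ∀ {n} → ℤ → Mat (suc n) → Set
Wraps {n} ε Q = ∀ (i : Fin n) → Q (suc i) zero ≡ ε * Q (inject₁ i) (fromℕ n)

toeplitz-diagonalConstant : ∀ {n} {H : Mat (suc n)} → IsToeplitz (suc n) H → DiagonalConstant H
toeplitz-diagonalConstant toeplitz i j =
  toeplitz (suc i) (suc j) (inject₁ i) (inject₁ j)
           (cong suc (sym (Finₚ.toℕ-inject₁ i))) (cong suc (sym (Finₚ.toℕ-inject₁ j)))

module _ {n : ℕ} {ε : ℤ} (a : ℕ → ℤ) where

  circulant-diagonalConstant : DiagonalConstant (circulant (suc n) ε a)
  circulant-diagonalConstant i j =
    trans (entry-alongDiagonal a (toℕ i) (toℕ j))
          (cong₂ (circulantEntry (suc n) ε a) (sym (Finₚ.toℕ-inject₁ i)) (sym (Finₚ.toℕ-inject₁ j)))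

  circulant-wraps : Wraps ε (circulant (suc n) ε a)
  circulant-wraps i = begin
    circulantEntry (suc n) ε a (suc (toℕ i)) 0
      ≡⟨ entry-below {suc n} {ε} a {suc (toℕ i)} (s≤s z≤n) ⟩
    ε * a (n ℕ.+ 0 ∸ toℕ i)
      ≡⟨ cong (λ m → ε * a (m ∸ toℕ i)) (ℕₚ.+-identityʳ n) ⟩
    ε * a (n ∸ toℕ i)
      ≡⟨ cong (ε *_) (sym (entry-above a (ℕₚ.<⇒≤ (Finₚ.toℕ<n i)))) ⟩
    ε * circulantEntry (suc n) ε a (toℕ i) n
      ≡⟨ cong (ε *_) (cong₂ (circulantEntry (suc n) ε a)
                            (sym (Finₚ.toℕ-inject₁ i)) (sym (Finₚ.toℕ-fromℕ n))) ⟩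
    ε * circulant (suc n) ε a (inject₁ i) (fromℕ n) ∎

first-row-determines : ∀ {n ε} {Q R : Mat (suc n)} →
  DiagonalConstant Q → Wraps ε Q → DiagonalConstant R → Wraps ε R →
  (∀ j → Q zero j ≡ R zero j) → Q ≋ R
first-row-determines {n} {ε} {Q} {R} diagQ wrapQ diagR wrapR firstRow =
  <-weakInduction (λ i → ∀ j → Q i j ≡ R i j) firstRow nextRow
  where
  nextRow : ∀ i → (∀ j → Q (inject₁ i) j ≡ R (inject₁ i) j) →
                   ∀ j → Q (suc i) j ≡ R (suc i) j
  nextRow i rowEq zero = begin
    Q (suc i) zero              ≡⟨ wrapQ i ⟩
    ε * Q (inject₁ i) (fromℕ n) ≡⟨ cong (ε *_) (rowEq (fromℕ n)) ⟩
    ε * R (inject₁ i) (fromℕ n) ≡⟨ sym (wrapR i) ⟩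
    R (suc i) zero              ∎
  nextRow i rowEq (suc j) = trans (diagQ i j) (trans (rowEq (inject₁ j)) (sym (diagR i j)))

wrapping-isPolynomial : ∀ {n ε} {H : Mat (suc n)} → DiagonalConstant H → Wraps ε H →
                        IsPolyIn H (shift (suc n) ε)
wrapping-isPolynomial {n} {ε} {H} diagH wrapH = cs , λ i j →
  trans (first-row-determines {ε = ε} diagH wrapH
           (circulant-diagonalConstant {n} {ε} a) (circulant-wraps {n} {ε} a) firstRow i j)
        (sym (polynomial-circulant cs i j))
  where
  cs = tabulate (H zero)
  a  = generator n ε cs
  firstRow : ∀ j → H zero j ≡ circulant (suc n) ε a zero j
  firstRow j = sym (trans (entry-above {suc n} {ε} a {c = toℕ j} z≤n)
                           (generator-tabulate {n} {ε} ℕₚ.≤-refl (H zero) j))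

IsSign : ℤ → Set
IsSign x = x ≡ 1ℤ ⊎ x ≡ - 1ℤ

sign-square : ∀ {x} → IsSign x → x * x ≡ 1ℤ
sign-square (inj₁ refl) = refl
sign-square (inj₂ refl) = refl

sign-product : ∀ {x y} → IsSign x → IsSign y → IsSign (x * y)
sign-product (inj₁ refl) (inj₁ refl) = inj₁ refl
sign-product (inj₁ refl) (inj₂ refl) = inj₂ refl
sign-product (inj₂ refl) (inj₁ refl) = inj₂ refl
sign-product (inj₂ refl) (inj₂ refl) = inj₁ refl

solve-for : ∀ {x y z w} → y * y ≡ 1ℤ → x * y ≡ z * w → x ≡ (y * w) * z
solve-for {x} {y} {z} {w} y²≡1 xy≡zw = begin
  x             ≡⟨ sym (ℤₚ.*-identityʳ x) ⟩
  x * 1ℤ        ≡⟨ cong (x *_) (sym y²≡1) ⟩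
  x * (y * y)   ≡⟨ sym (ℤₚ.*-assoc x y y) ⟩
  (x * y) * y   ≡⟨ cong (_* y) xy≡zw ⟩
  (z * w) * y   ≡⟨ ℤₚ.*-comm (z * w) y ⟩
  y * (z * w)   ≡⟨ cong (y *_) (ℤₚ.*-comm z w) ⟩
  y * (w * z)   ≡⟨ sym (ℤₚ.*-assoc y w z) ⟩
  (y * w) * z   ∎

rows-orthogonal : ∀ {v} {H : Mat v} → IsHadamard v H → (i k : Fin v) → toℕ i ≢ toℕ k →
                  ∑ (λ j → H i j * H k j) ≡ 0ℤ
rows-orthogonal {v} (_ , HHᵀ≡vI) i k i≢k =
  trans (HHᵀ≡vI i k)
        (trans (cong (ℤ.+ v *_) (identity-offDiagonal i k i≢k)) (ℤₚ.*-zeroʳ (ℤ.+ v)))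

-- Rows i+1, k+1 and rows i, k of a diagonal-constant matrix share all products
-- but the first, resp. the last; orthogonality of both pairs equates those.
corner-products : ∀ {n} {H : Mat (suc n)} → IsHadamard (suc n) H → DiagonalConstant H →
  (i k : Fin n) → toℕ i ≢ toℕ k →
  H (suc i) zero * H (suc k) zero ≡ H (inject₁ i) (fromℕ n) * H (inject₁ k) (fromℕ n)
corner-products {n} {H} hadamard diag i k i≢k =
  trans (inverseˡ-unique _ _ shiftedRows) (sym (inverseʳ-unique _ _ unshiftedRows))
  where
  common = ∑ (λ j → H (inject₁ i) (inject₁ j) * H (inject₁ k) (inject₁ j))
  shiftedRows : H (suc i) zero * H (suc k) zero + common ≡ 0ℤ
  shiftedRows =
    trans (cong (H (suc i) zero * H (suc k) zero +_)
                (∑-cong (λ j → sym (cong₂ _*_ (diag i j) (diag k j)))))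
          (rows-orthogonal hadamard (suc i) (suc k) (i≢k ∘ ℕₚ.suc-injective))
  unshiftedRows : common + H (inject₁ i) (fromℕ n) * H (inject₁ k) (fromℕ n) ≡ 0ℤ
  unshiftedRows =
    trans (sym (∑-last (λ j → H (inject₁ i) j * H (inject₁ k) j)))
          (rows-orthogonal hadamard (inject₁ i) (inject₁ k)
            λ eq → i≢k (trans (sym (Finₚ.toℕ-inject₁ i)) (trans eq (Finₚ.toℕ-inject₁ k))))

hadamard-wraps : ∀ {n} {H : Mat (suc n)} → IsHadamard (suc n) H → DiagonalConstant H →
                 ∃ λ ε → IsSign ε × Wraps ε H
hadamard-wraps {zero}  _ _ = 1ℤ , inj₁ refl , λ ()
hadamard-wraps {suc m} {H} hadamard@(signs , _) diag =
  H (suc zero) zero * H zero lastCol , sign-product (signs _ _) (signs _ _) , wrap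
  where
  lastCol = fromℕ (suc m)
  h₁₀² = sign-square (signs (suc zero) zero)
  wrap : Wraps (H (suc zero) zero * H zero lastCol) H
  wrap zero    = solve-for h₁₀² (trans h₁₀² (sym (sign-square (signs zero lastCol))))
  wrap (suc i) = solve-for h₁₀² (corner-products hadamard diag (suc i) zero λ ())

cyclic-or-negacyclic : ∀ {v ε} {H : Mat v} → IsSign ε → IsPolyIn H (shift v ε) →
                       IsCyclic v H ⊎ IsNegacyclic v H
cyclic-or-negacyclic (inj₁ refl) polynomial = inj₁ polynomial
cyclic-or-negacyclic (inj₂ refl) polynomial = inj₂ polynomial

proposition1 : (v : ℕ) → v % 4 ≡ 0 → (H : Mat v) →
    IsHadamard v H → IsToeplitz v H → IsCyclic v H ⊎ IsNegacyclic v H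
proposition1 zero    _ H _         _        = inj₁ ([] , λ ())
proposition1 (suc n) _ H hadamard toeplitz
  with diag ← toeplitz-diagonalConstant toeplitz
  with _ , sign , wrap ← hadamard-wraps hadamard diag
  = cyclic-or-negacyclic sign (wrapping-isPolynomial diag wrap)
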